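{- Let $G=(V,E)$ be a finite simple graph with $V\neq\emptyset$, and let $P_G$ be its face poset. Then the graph associahedron $\mathcal{K}G$ is combinatorially equivalent to the poset associahedron $\mathcal{K}P_G$; i.e., the poset of tubings of $G$ ordered by reverse containment is isomorphic to the poset of tubings of $P_G$ ordered by reverse containment.
   Context: Face poset of $G$: the poset on $V\sqcup E$ in which $v\prec e$ iff $v\in V$ is an endpoint of $e\in E$, and there are no other strict relations. Graph tubings: a tube of $G$ is a nonempty subset of $V$ inducing a connected subgraph; a tubing of $G$ is a set of tubes of $G$, none equal to $V$, any two of which are either nested or disjoint, and such that no two disjoint tubes in it are joined by an edge of $G$. The graph associahedron $\mathcal{K}G$ is a convex polytope whose poset of nonempty faces (ordered by inclusion) is isomorphic to the set of tubings of $G$ ordered by reverse containment. Poset tubings: for a finite poset $(P,\preceq)$, a lower set is $L\subseteq P$ with $y\preceq x\in L\Rightarrow y\in L$; $\partial x=\{y: y\prec x\}$; $\mathrm{bu}(x)=\{y:\partial y=\partial x\}$; a subset is connected if it induces a connected subgraph of the Hasse diagram; a lower set $L$ is filled if $\partial x\subseteq L$ implies $L\cap\mathrm{bu}(x)\ne\emptyset$ for all $x\in P$; a tube is a filled connected lower set; a tubing is a set of tubes, none equal to $P$, pairwise disjoint or nested, such that the union of every nonempty subset is filled. The poset associahedron $\mathcal{K}P$ is a convex polytope whose poset of nonempty faces is isomorphic to the set of tubings of $P$ ordered by reverse containment (such a polytope exists and is unique up to combinatorial equivalence). -}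

module Defs where

open import Data.Nat using (ℕ; _+_)
open import Data.Fin using (Fin; _↑ˡ_; _↑ʳ_)
open import Data.Fin.Subset using (Subset; _∈_; _∉_; _⊆_; ⊤)
open import Data.Bool using (Bool; true)
open import Data.Product using (Σ; ∃; _×_; _,_; proj₁; proj₂)
open import Data.Sum using (_⊎_; inj₁; inj₂)
open import Data.Empty using (⊥)
open import Relation.Nullary using (¬_)
open import Relation.Binary.PropositionalEquality using (_≡_; _≢_)
open import Function.Bundles using (_⇔_)

-- Path Adj S x y : a walk x = x₀, x₁, …, xₖ = y along Adj whose vertices
-- after x all lie in S (x itself is assumed in S by the user).
data Path {k : ℕ} (Adj : Fin k → Fin k → Set) (S : Fin k → Set)
          : Fin k → Fin k → Set where
  here : ∀ {x} → Path Adj S x x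
  step : ∀ {x y z} → Adj x y → S y → Path Adj S y z → Path Adj S x z

ConnectedIn : {k : ℕ} → (Fin k → Fin k → Set) → (Fin k → Set) → Set
ConnectedIn {k} Adj S = (x y : Fin k) → S x → S y → Path Adj S x y

Coll : ℕ → Set
Coll k = Subset k → Bool

_∈ᶜ_ : {k : ℕ} → Subset k → Coll k → Set
t ∈ᶜ T = T t ≡ true

_⊆ᶜ_ : {k : ℕ} → Coll k → Coll k → Set
T ⊆ᶜ T' = ∀ t → t ∈ᶜ T → t ∈ᶜ T'

_≈ᶜ_ : {k : ℕ} → Coll k → Coll k → Set
T ≈ᶜ T' = ∀ t → T t ≡ T' t

Disjoint : {k : ℕ} → Subset k → Subset k → Set
Disjoint {k} s t = (x : Fin k) → x ∈ s → x ∉ t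

NestedOrDisjoint : {k : ℕ} → Subset k → Subset k → Set
NestedOrDisjoint s t = (s ⊆ t ⊎ t ⊆ s) ⊎ Disjoint s t

record Graph (n : ℕ) : Set where
  field
    m        : ℕ                       -- number of edges, E = Fin m
    ends     : Fin m → Fin n × Fin n
    loopless : (e : Fin m) → proj₁ (ends e) ≢ proj₂ (ends e)
    simple   : (e e' : Fin m) →
               (ends e ≡ ends e' ⊎ (proj₁ (ends e) ≡ proj₂ (ends e') ×
                                    proj₂ (ends e) ≡ proj₁ (ends e'))) →
               e ≡ e'

module _ {n : ℕ} (G : Graph n) where
  open Graph G

  Endpoint : Fin n → Fin m → Set
  Endpoint v e = v ≡ proj₁ (ends e) ⊎ v ≡ proj₂ (ends e)

  Adj : Fin n → Fin n → Set
  Adj u v = ∃ λ e → (ends e ≡ (u , v)) ⊎ (ends e ≡ (v , u))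

  IsGraphTube : Subset n → Set
  IsGraphTube t = (∃ λ v → v ∈ t) × ConnectedIn Adj (_∈ t)

  record IsGraphTubing (T : Coll n) : Set where
    field
      tubes     : ∀ t → t ∈ᶜ T → IsGraphTube t
      proper    : ∀ t → t ∈ᶜ T → t ≢ ⊤
      nestdisj  : ∀ t t' → t ∈ᶜ T → t' ∈ᶜ T → NestedOrDisjoint t t'
      nonadj    : ∀ t t' → t ∈ᶜ T → t' ∈ᶜ T → Disjoint t t' →
                  ∀ u v → u ∈ t → v ∈ t' → ¬ Adj u v

  GraphTubing : Set
  GraphTubing = Σ (Coll n) IsGraphTubing

module _ {k : ℕ} (_≺_ : Fin k → Fin k → Set) where

  _⋖_ : Fin k → Fin k → Set
  x ⋖ y = x ≺ y × ¬ (∃ λ z → x ≺ z × z ≺ y)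

  HasseAdj : Fin k → Fin k → Set
  HasseAdj x y = x ⋖ y ⊎ y ⋖ x

  IsLowerSet : (Fin k → Set) → Set
  IsLowerSet L = ∀ x y → y ≺ x → L x → L y

  ∂⊆ : Fin k → (Fin k → Set) → Set
  ∂⊆ x L = ∀ y → y ≺ x → L y

  InBu : Fin k → Fin k → Set
  InBu x y = ∀ z → (z ≺ y ⇔ z ≺ x)

  IsFilled : (Fin k → Set) → Set
  IsFilled L = ∀ x → ∂⊆ x L → ∃ λ y → InBu x y × L y

  IsPosetTube : Subset k → Set
  IsPosetTube t = IsFilled (_∈ t) × ConnectedIn HasseAdj (_∈ t) × IsLowerSet (_∈ t)

  ⋃ᶜ : Coll k → Fin k → Set
  ⋃ᶜ S x = ∃ λ t → t ∈ᶜ S × x ∈ t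

  record IsPosetTubing (T : Coll k) : Set where
    field
      tubes     : ∀ t → t ∈ᶜ T → IsPosetTube t
      proper    : ∀ t → t ∈ᶜ T → t ≢ ⊤
      nestdisj  : ∀ t t' → t ∈ᶜ T → t' ∈ᶜ T → NestedOrDisjoint t t'
      unions    : ∀ (S : Coll k) → S ⊆ᶜ T → (∃ λ t → t ∈ᶜ S) → IsFilled (⋃ᶜ S)

  PosetTubing : Set
  PosetTubing = Σ (Coll k) IsPosetTubing

-- Face poset of a graph: carrier Fin (n + m), vertex v ↦ v ↑ˡ m,
-- edge e ↦ n ↑ʳ e;  v ≺ e iff v is an endpoint of e.

module _ {n : ℕ} (G : Graph n) where
  open Graph G

  FaceLt : Fin (n + m) → Fin (n + m) → Set
  FaceLt x y = ∃ λ v → ∃ λ e → x ≡ v ↑ˡ m × y ≡ n ↑ʳ e × Endpoint G v e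

-- Order isomorphism between two collections-of-tubings posets,
-- both ordered by reverse containment (T ≤ T' iff T' ⊆ T).

record TubingIso {a b : ℕ} {A : Coll a → Set} {B : Coll b → Set} : Set where
  field
    to       : Σ (Coll a) A → Σ (Coll b) B
    from     : Σ (Coll b) B → Σ (Coll a) A
    to-order : ∀ T T' → (proj₁ T' ⊆ᶜ proj₁ T) ⇔ (proj₁ (to T') ⊆ᶜ proj₁ (to T))
    from-order : ∀ U U' → (proj₁ U' ⊆ᶜ proj₁ U) ⇔ (proj₁ (from U') ⊆ᶜ proj₁ (from U))
    from∘to  : ∀ T → proj₁ (from (to T)) ≈ᶜ proj₁ T
    to∘from  : ∀ U → proj₁ (to (from U)) ≈ᶜ proj₁ U

-- A set W of vertices of G corresponds to the set of faces induced by W: the vertices of W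
-- together with the edges having both ends in W.  In the face poset every vertex has empty
-- boundary, so the vertices form a single bunch, while an edge is determined by its two ends
-- (G is simple), so each edge is alone in its bunch.  Hence a subset of the face poset is
-- filled iff it contains a vertex and every edge whose two ends it contains.  Consequently the
-- tubes of the face poset are exactly the induced sets of graph tubes (a Hasse path alternates
-- vertex, edge, vertex, so connectivity transfers), nesting and disjointness transfer, and the
-- filledness of a union of disjoint tubes is exactly the non-adjacency condition of graph
-- tubings.
module Submission where

open import Defs
open import Data.Nat using (ℕ; suc; _+_; _<_)
open import Data.Fin using (Fin; zero; _↑ˡ_; _↑ʳ_; splitAt)
open import Data.Fin.Properties using (splitAt-↑ˡ; splitAt-↑ʳ; join-splitAt; ↑ˡ-injective; ↑ʳ-injective)
open import Data.Fin.Subset using (Subset; _∈_; _⊆_; ⊤)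
open import Data.Fin.Subset.Properties using (⊆-antisym; ⊆⊤; ∈⊤)
open import Data.Vec using (lookup; tabulate; _++_)
open import Data.Vec.Properties using (lookup-++ˡ; lookup-++ʳ; lookup∘tabulate; ≡-dec; []=⇒lookup; lookup⇒[]=)
open import Data.Bool using (true; false; _∧_; _∨_)
open import Data.Bool.Properties using (∧-identityʳ; ∧-zeroʳ; ∧-conicalˡ; ∧-conicalʳ; ∨-zeroʳ) renaming (_≟_ to _≟ᵇ_)
open import Data.Product using (∃; _×_; _,_; proj₁; proj₂)
open import Data.Sum as Sum using (_⊎_; inj₁; inj₂; [_,_]′)
open import Data.Empty using (⊥; ⊥-elim)
open import Function using (id)
open import Function.Bundles using (mk⇔; Equivalence)
open import Relation.Nullary using (¬_; Dec; yes; no; does)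
open import Relation.Nullary.Decidable using (dec-true)
open import Relation.Binary.PropositionalEquality using (_≡_; _≢_; refl; sym; trans; cong; cong₂; subst; subst₂)

Path-++ : ∀ {k} {A : Fin k → Fin k → Set} {S : Fin k → Set} {x y z} →
          Path A S x y → Path A S y z → Path A S x z
Path-++ here         q = q
Path-++ (step a s p) q = step a s (Path-++ p q)

Path-concatMap : ∀ {k l} {A : Fin k → Fin k → Set} {S : Fin k → Set}
                 {B : Fin l → Fin l → Set} {T : Fin l → Set} (f : Fin k → Fin l) →
                 (∀ {x y} → S x → A x y → S y → Path B T (f x) (f y)) →
                 ∀ {x y} → S x → Path A S x y → Path B T (f x) (f y)
Path-concatMap f g sx here          = here
Path-concatMap f g sx (step a sy p) = Path-++ (g sx a sy) (Path-concatMap f g sy p)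

does⇒ : ∀ {A : Set} (a? : Dec A) → does a? ≡ true → A
does⇒ (yes a) _ = a

∈-by-lookup : ∀ {k l} {s : Subset k} {t : Subset l} {x y} →
              lookup t y ≡ lookup s x → x ∈ s → y ∈ t
∈-by-lookup {t = t} {y = y} eq x∈s = lookup⇒[]= y t (trans eq ([]=⇒lookup x∈s))

_≟ˢ_ : ∀ {k} (s t : Subset k) → Dec (s ≡ t)
_≟ˢ_ = ≡-dec _≟ᵇ_

pair : ∀ {k} → Subset k → Subset k → Coll k
pair s t r = does (r ≟ˢ s) ∨ does (r ≟ˢ t)

∈pairˡ : ∀ {k} (s t : Subset k) → s ∈ᶜ pair s t
∈pairˡ s t = cong (_∨ does (s ≟ˢ t)) (dec-true (s ≟ˢ s) refl)

∈pairʳ : ∀ {k} (s t : Subset k) → t ∈ᶜ pair s t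
∈pairʳ s t = trans (cong (does (t ≟ˢ s) ∨_) (dec-true (t ≟ˢ t) refl)) (∨-zeroʳ _)

module _ {k} {s t : Subset k} where

  ∈pair⁻ : ∀ {r} → r ∈ᶜ pair s t → r ≡ s ⊎ r ≡ t
  ∈pair⁻ {r} r∈ with r ≟ˢ s | r ≟ˢ t | r∈
  ... | yes r≡s | _       | _  = inj₁ r≡s
  ... | no _    | yes r≡t | _  = inj₂ r≡t
  ... | no _    | no _    | ()

  pair-⊆ : ∀ {U} → s ∈ᶜ U → t ∈ᶜ U → pair s t ⊆ᶜ U
  pair-⊆ s∈ t∈ r r∈ with ∈pair⁻ {r} r∈
  ... | inj₁ refl = s∈
  ... | inj₂ refl = t∈

module Transport {a b : ℕ} (lift : Subset a → Subset b) (res : Subset b → Subset a)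
                 (res∘lift : ∀ W → res (lift W) ≡ W) where

  -- s belongs to image T iff s = lift W for some W ∈ T; since res is a left inverse of lift,
  -- that W can only be res s.
  image : Coll a → Coll b
  image T s = T (res s) ∧ does (s ≟ˢ lift (res s))

  preimage : Coll b → Coll a
  preimage U W = U (lift W)

  data InImage (T : Coll a) : Subset b → Set where
    image⁺ : ∀ {W} → W ∈ᶜ T → InImage T (lift W)

  ∈image⁻ : ∀ {T s} → s ∈ᶜ image T → InImage T s
  ∈image⁻ {T} {s} s∈ =
    subst (InImage T) (sym (does⇒ (s ≟ˢ lift (res s)) (∧-conicalʳ _ _ s∈)))
          (image⁺ (∧-conicalˡ _ _ s∈))

  image-lift : ∀ T W → image T (lift W) ≡ T W
  image-lift T W rewrite res∘lift W | dec-true (lift W ≟ˢ lift W) refl = ∧-identityʳ (T W)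

  Lifts : Coll b → Set
  Lifts U = ∀ s → s ∈ᶜ U → s ≡ lift (res s)

  image∘preimage : ∀ {U} → Lifts U → image (preimage U) ≈ᶜ U
  image∘preimage {U} lifts s with s ≟ˢ lift (res s)
  ... | yes s≡ = trans (∧-identityʳ _) (cong U (sym s≡))
  ... | no s≢ with U s in Us
  ...   | true  = ⊥-elim (s≢ (lifts s Us))
  ...   | false = ∧-zeroʳ _

  image-mono : ∀ {T T'} → T' ⊆ᶜ T → image T' ⊆ᶜ image T
  image-mono {T} {T'} T'⊆T s s∈ with ∈image⁻ {T'} {s} s∈
  ... | image⁺ {W} W∈ = trans (image-lift T W) (T'⊆T W W∈)

  image-⊆⁻ : ∀ {T T'} → image T' ⊆ᶜ image T → T' ⊆ᶜ T
  image-⊆⁻ {T} {T'} h W W∈ = trans (sym (image-lift T W)) (h (lift W) (trans (image-lift T' W) W∈))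

  preimage-⊆⁻ : ∀ {U U'} → Lifts U' → preimage U' ⊆ᶜ preimage U → U' ⊆ᶜ U
  preimage-⊆⁻ {U} {U'} lifts h s s∈ =
    subst (_∈ᶜ U) (sym (lifts s s∈)) (h (res s) (subst (_∈ᶜ U') (lifts s s∈) s∈))

  tubingIso : {A : Coll a → Set} {B : Coll b → Set} →
              (∀ {T} → A T → B (image T)) → (∀ {U} → B U → A (preimage U)) →
              (∀ {U} → B U → Lifts U) → TubingIso {a} {b} {A} {B}
  tubingIso A⇒B B⇒A B⇒Lifts = record
    { to         = λ (T , tT) → image T , A⇒B tT
    ; from       = λ (U , tU) → preimage U , B⇒A tU
    ; to-order   = λ _ _ → mk⇔ image-mono image-⊆⁻
    ; from-order = λ _ (_ , tU') → mk⇔ (λ h W → h (lift W)) (preimage-⊆⁻ (B⇒Lifts tU'))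
    ; from∘to    = λ (T , _) → image-lift T
    ; to∘from    = λ (_ , tU) → image∘preimage (B⇒Lifts tU)
    }

module FacePoset {n : ℕ} (G : Graph n) where
  open Graph G

  _≺_ : Fin (n + m) → Fin (n + m) → Set
  _≺_ = FaceLt G

  Hasse : Fin (n + m) → Fin (n + m) → Set
  Hasse = HasseAdj _≺_

  vertex : Fin n → Fin (n + m)
  vertex v = v ↑ˡ m

  edge : Fin m → Fin (n + m)
  edge e = n ↑ʳ e

  end₁ end₂ : Fin m → Fin n
  end₁ e = proj₁ (ends e)
  end₂ e = proj₂ (ends e)

  vertex≢edge : ∀ v e → vertex v ≢ edge e
  vertex≢edge v e eq with trans (sym (splitAt-↑ˡ n v m)) (trans (cong (splitAt n) eq) (splitAt-↑ʳ n m e))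
  ... | ()

  data Face : Fin (n + m) → Set where
    vertexᶠ : ∀ v → Face (vertex v)
    edgeᶠ   : ∀ e → Face (edge e)

  face : ∀ x → Face x
  face x with splitAt n x | join-splitAt n m x
  ... | inj₁ v | refl = vertexᶠ v
  ... | inj₂ e | refl = edgeᶠ e

  -- Hasse paths are projected to paths in G by sending each face to one of its vertices.
  anchor : Fin (n + m) → Fin n
  anchor x = [ id , end₁ ]′ (splitAt n x)

  anchor-vertex : ∀ v → anchor (vertex v) ≡ v
  anchor-vertex v = cong [ id , end₁ ]′ (splitAt-↑ˡ n v m)

  anchor-edge : ∀ e → anchor (edge e) ≡ end₁ e
  anchor-edge e = cong [ id , end₁ ]′ (splitAt-↑ʳ n m e)

  endpoint-elim : ∀ {v e} (Q : Fin n → Set) → Endpoint G v e → Q (end₁ e) → Q (end₂ e) → Q v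
  endpoint-elim Q (inj₁ refl) q₁ q₂ = q₁
  endpoint-elim Q (inj₂ refl) q₁ q₂ = q₂

  ends⇒≡ : ∀ {e e'} → Endpoint G (end₁ e') e → Endpoint G (end₂ e') e → e' ≡ e
  ends⇒≡ {e' = e'} (inj₁ p) (inj₁ q) = ⊥-elim (loopless e' (trans p (sym q)))
  ends⇒≡           (inj₁ p) (inj₂ q) = simple _ _ (inj₁ (cong₂ _,_ p q))
  ends⇒≡           (inj₂ p) (inj₁ q) = simple _ _ (inj₂ (p , q))
  ends⇒≡ {e' = e'} (inj₂ p) (inj₂ q) = ⊥-elim (loopless e' (trans p (sym q)))

  endpoint⇒≺ : ∀ {v e} → Endpoint G v e → vertex v ≺ edge e
  endpoint⇒≺ ep = _ , _ , refl , refl , ep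

  ≺⇒endpoint : ∀ {v e} → vertex v ≺ edge e → Endpoint G v e
  ≺⇒endpoint {v} {e} (w , e' , v≡w , e≡e' , ep) =
    subst₂ (Endpoint G) (sym (↑ˡ-injective m v w v≡w)) (sym (↑ʳ-injective n e e' e≡e')) ep

  ⊀vertex : ∀ {x} v → ¬ (x ≺ vertex v)
  ⊀vertex v (_ , e , _ , v≡e , _) = vertex≢edge v e v≡e

  edge⊀ : ∀ {x} e → ¬ (edge e ≺ x)
  edge⊀ e (w , _ , e≡w , _) = vertex≢edge w e (sym e≡w)

  -- The face poset has height one, so every relation is a covering.
  ≺⇒⋖ : ∀ {x y} → x ≺ y → _⋖_ _≺_ x y
  ≺⇒⋖ x≺y = x≺y , λ { (z , (_ , e , _ , z≡e , _) , z≺y) → edge⊀ e (subst (_≺ _) z≡e z≺y) }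

  hasse-up : ∀ {v e} → Endpoint G v e → Hasse (vertex v) (edge e)
  hasse-up ep = inj₁ (≺⇒⋖ (endpoint⇒≺ ep))

  hasse-down : ∀ {v e} → Endpoint G v e → Hasse (edge e) (vertex v)
  hasse-down ep = inj₂ (≺⇒⋖ (endpoint⇒≺ ep))

  bunch-refl : ∀ x → InBu _≺_ x x
  bunch-refl x z = mk⇔ id id

  vertex-bunch : ∀ v w → InBu _≺_ (vertex v) (vertex w)
  vertex-bunch v w z = mk⇔ (λ z≺w → ⊥-elim (⊀vertex w z≺w)) (λ z≺v → ⊥-elim (⊀vertex v z≺v))

  vertex-bunch⁻ : ∀ {v y} → InBu _≺_ (vertex v) y → ∃ λ w → y ≡ vertex w
  vertex-bunch⁻ {v} {y} bu with face y
  ... | vertexᶠ w = w , refl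
  ... | edgeᶠ e   = ⊥-elim (⊀vertex v (Equivalence.to (bu _) (endpoint⇒≺ {e = e} (inj₁ refl))))

  edge-bunch⁻ : ∀ {e y} → InBu _≺_ (edge e) y → y ≡ edge e
  edge-bunch⁻ {e} {y} bu with face y
  ... | vertexᶠ w = ⊥-elim (⊀vertex w (Equivalence.from (bu _) (endpoint⇒≺ {e = e} (inj₁ refl))))
  ... | edgeᶠ e'  = cong edge (ends⇒≡ (≺⇒endpoint (Equivalence.to (bu _) (endpoint⇒≺ (inj₁ refl))))
                                      (≺⇒endpoint (Equivalence.to (bu _) (endpoint⇒≺ (inj₂ refl)))))

  EdgeClosed : (Fin (n + m) → Set) → Set
  EdgeClosed L = ∀ e → L (vertex (end₁ e)) → L (vertex (end₂ e)) → L (edge e)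

  ∂edge⊆ : ∀ {e} (L : Fin (n + m) → Set) → L (vertex (end₁ e)) → L (vertex (end₂ e)) →
           ∂⊆ _≺_ (edge e) L
  ∂edge⊆ {e} L L₁ L₂ _ (_ , e' , refl , e≡e' , ep) with ↑ʳ-injective n e e' e≡e'
  ... | refl = endpoint-elim (λ w → L (vertex w)) ep L₁ L₂

  filled-intro : ∀ (L : Fin (n + m) → Set) → (∃ λ v → L (vertex v)) → EdgeClosed L →
                 IsFilled _≺_ L
  filled-intro L (w , Lw) closed x ∂x⊆L with face x
  ... | vertexᶠ v = vertex w , vertex-bunch v w , Lw
  ... | edgeᶠ e   = edge e , bunch-refl (edge e) ,
                    closed e (∂x⊆L _ (endpoint⇒≺ (inj₁ refl))) (∂x⊆L _ (endpoint⇒≺ (inj₂ refl)))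

  filled⇒vertex : ∀ {L} → Fin n → IsFilled _≺_ L → ∃ λ v → L (vertex v)
  filled⇒vertex v₀ filled with filled (vertex v₀) (λ _ z≺v₀ → ⊥-elim (⊀vertex v₀ z≺v₀))
  ... | _ , bu , Ly with vertex-bunch⁻ bu
  ...   | w , refl = w , Ly

  filled⇒edgeClosed : ∀ {L} → IsFilled _≺_ L → EdgeClosed L
  filled⇒edgeClosed {L} filled e L₁ L₂ with filled (edge e) (∂edge⊆ L L₁ L₂)
  ... | _ , bu , Ly = subst L (edge-bunch⁻ bu) Ly

  induced : Subset n → Subset (n + m)
  induced W = W ++ tabulate (λ e → lookup W (end₁ e) ∧ lookup W (end₂ e))

  vertices : Subset (n + m) → Subset n
  vertices s = tabulate (λ v → lookup s (vertex v))

  module _ {W : Subset n} where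

    vertex∈⁺ : ∀ {v} → v ∈ W → vertex v ∈ induced W
    vertex∈⁺ {v} = ∈-by-lookup (lookup-++ˡ W _ v)

    vertex∈⁻ : ∀ {v} → vertex v ∈ induced W → v ∈ W
    vertex∈⁻ {v} = ∈-by-lookup (sym (lookup-++ˡ W _ v))

    lookup-edge : ∀ e → lookup (induced W) (edge e) ≡ lookup W (end₁ e) ∧ lookup W (end₂ e)
    lookup-edge e = trans (lookup-++ʳ W _ e) (lookup∘tabulate _ e)

    edge∈⁺ : ∀ {e} → end₁ e ∈ W → end₂ e ∈ W → edge e ∈ induced W
    edge∈⁺ {e} p q = lookup⇒[]= (edge e) (induced W)
                       (trans (lookup-edge e) (cong₂ _∧_ ([]=⇒lookup p) ([]=⇒lookup q)))

    edge∈⁻ : ∀ {e} → edge e ∈ induced W → end₁ e ∈ W × end₂ e ∈ W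
    edge∈⁻ {e} p = lookup⇒[]= _ W (∧-conicalˡ _ _ both) , lookup⇒[]= _ W (∧-conicalʳ _ _ both)
      where
      both : lookup W (end₁ e) ∧ lookup W (end₂ e) ≡ true
      both = trans (sym (lookup-edge e)) ([]=⇒lookup p)

  vertices∈⁺ : ∀ {s v} → vertex v ∈ s → v ∈ vertices s
  vertices∈⁺ {v = v} = ∈-by-lookup (lookup∘tabulate _ v)

  vertices∈⁻ : ∀ {s v} → v ∈ vertices s → vertex v ∈ s
  vertices∈⁻ {v = v} = ∈-by-lookup (sym (lookup∘tabulate _ v))

  vertices∘induced : ∀ W → vertices (induced W) ≡ W
  vertices∘induced W =
    ⊆-antisym (λ p → vertex∈⁻ (vertices∈⁻ p)) (λ p → vertices∈⁺ (vertex∈⁺ p))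

  induced-injective : ∀ {W W'} → induced W ≡ induced W' → W ≡ W'
  induced-injective {W} {W'} eq =
    trans (sym (vertices∘induced W)) (trans (cong vertices eq) (vertices∘induced W'))

  induced-⊤ : induced ⊤ ≡ ⊤
  induced-⊤ = ⊆-antisym ⊆⊤ (λ {x} _ → ∈induced-⊤ x)
    where
    ∈induced-⊤ : ∀ x → x ∈ induced ⊤
    ∈induced-⊤ x with face x
    ... | vertexᶠ v = vertex∈⁺ ∈⊤
    ... | edgeᶠ e   = edge∈⁺ ∈⊤ ∈⊤

  induced-mono : ∀ {W W'} → W ⊆ W' → induced W ⊆ induced W'
  induced-mono W⊆W' {x} p with face x
  ... | vertexᶠ v = vertex∈⁺ (W⊆W' (vertex∈⁻ p))
  ... | edgeᶠ e   = edge∈⁺ (W⊆W' (proj₁ (edge∈⁻ p))) (W⊆W' (proj₂ (edge∈⁻ p)))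

  induced-⊆⁻ : ∀ {W W'} → induced W ⊆ induced W' → W ⊆ W'
  induced-⊆⁻ h p = vertex∈⁻ (h (vertex∈⁺ p))

  induced-disjoint : ∀ {W W'} → Disjoint W W' → Disjoint (induced W) (induced W')
  induced-disjoint disj x p q with face x
  ... | vertexᶠ v = disj v (vertex∈⁻ p) (vertex∈⁻ q)
  ... | edgeᶠ e   = disj (end₁ e) (proj₁ (edge∈⁻ p)) (proj₁ (edge∈⁻ q))

  induced-disjoint⁻ : ∀ {W W'} → Disjoint (induced W) (induced W') → Disjoint W W'
  induced-disjoint⁻ disj v p q = disj (vertex v) (vertex∈⁺ p) (vertex∈⁺ q)

  induced-nestedOrDisjoint : ∀ {W W'} → NestedOrDisjoint W W' →
                             NestedOrDisjoint (induced W) (induced W')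
  induced-nestedOrDisjoint = Sum.map (Sum.map induced-mono induced-mono) induced-disjoint

  induced-nestedOrDisjoint⁻ : ∀ {W W'} → NestedOrDisjoint (induced W) (induced W') →
                              NestedOrDisjoint W W'
  induced-nestedOrDisjoint⁻ = Sum.map (Sum.map induced-⊆⁻ induced-⊆⁻) induced-disjoint⁻

  Joins : Fin m → Fin n → Fin n → Set
  Joins e u w = (end₁ e ≡ u × end₂ e ≡ w) ⊎ (end₁ e ≡ w × end₂ e ≡ u)

  adj⇒joins : ∀ {u w} → Adj G u w → ∃ λ e → Joins e u w
  adj⇒joins (e , inj₁ eq) = e , inj₁ (cong proj₁ eq , cong proj₂ eq)
  adj⇒joins (e , inj₂ eq) = e , inj₂ (cong proj₁ eq , cong proj₂ eq)

  through-edge : ∀ {X u w e} → Endpoint G u e → Endpoint G w e → edge e ∈ X → vertex w ∈ X →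
                 Path Hasse (_∈ X) (vertex u) (vertex w)
  through-edge eu ew e∈ w∈ = step (hasse-up eu) e∈ (step (hasse-down ew) w∈ here)

  adj⇒hasse-path : ∀ {W u w} → u ∈ W → Adj G u w → w ∈ W →
                   Path Hasse (_∈ induced W) (vertex u) (vertex w)
  adj⇒hasse-path u∈ adj w∈ with adj⇒joins adj
  ... | _ , inj₁ (refl , refl) = through-edge (inj₁ refl) (inj₂ refl) (edge∈⁺ u∈ w∈) (vertex∈⁺ w∈)
  ... | _ , inj₂ (refl , refl) = through-edge (inj₂ refl) (inj₁ refl) (edge∈⁺ w∈ u∈) (vertex∈⁺ w∈)

  endpoints-joined : ∀ {W e u w} → edge e ∈ induced W → Endpoint G u e → Endpoint G w e →
                     Path (Adj G) (_∈ W) u w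
  endpoints-joined         e∈ (inj₁ refl) (inj₁ refl) = here
  endpoints-joined {e = e} e∈ (inj₁ refl) (inj₂ refl) = step (e , inj₁ refl) (proj₂ (edge∈⁻ e∈)) here
  endpoints-joined {e = e} e∈ (inj₂ refl) (inj₁ refl) = step (e , inj₂ refl) (proj₁ (edge∈⁻ e∈)) here
  endpoints-joined         e∈ (inj₂ refl) (inj₂ refl) = here

  anchor-step : ∀ {W x y} → x ∈ induced W → Hasse x y → y ∈ induced W →
                Path (Adj G) (_∈ W) (anchor x) (anchor y)
  anchor-step _ (inj₁ ((v , e , refl , refl , ep) , _)) e∈
    rewrite anchor-vertex v | anchor-edge e = endpoints-joined e∈ ep (inj₁ refl)
  anchor-step e∈ (inj₂ ((v , e , refl , refl , ep) , _)) _
    rewrite anchor-vertex v | anchor-edge e = endpoints-joined e∈ (inj₁ refl) ep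

  anchor∈ : ∀ {W x} → x ∈ induced W → anchor x ∈ W
  anchor∈ {x = x} p with face x
  ... | vertexᶠ v rewrite anchor-vertex v = vertex∈⁻ p
  ... | edgeᶠ e   rewrite anchor-edge e   = proj₁ (edge∈⁻ p)

  to-anchor : ∀ {W x} → x ∈ induced W → Path Hasse (_∈ induced W) x (vertex (anchor x))
  to-anchor {x = x} p with face x
  ... | vertexᶠ v rewrite anchor-vertex v = here
  ... | edgeᶠ e   rewrite anchor-edge e   =
    step (hasse-down (inj₁ refl)) (vertex∈⁺ (proj₁ (edge∈⁻ p))) here

  from-anchor : ∀ {W x} → x ∈ induced W → Path Hasse (_∈ induced W) (vertex (anchor x)) x
  from-anchor {x = x} p with face x
  ... | vertexᶠ v rewrite anchor-vertex v = here
  ... | edgeᶠ e   rewrite anchor-edge e   = step (hasse-up (inj₁ refl)) p here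

  induced-connected : ∀ {W} → ConnectedIn (Adj G) (_∈ W) → ConnectedIn Hasse (_∈ induced W)
  induced-connected conn x y x∈ y∈ =
    Path-++ (to-anchor x∈)
      (Path-++ (Path-concatMap vertex adj⇒hasse-path (anchor∈ x∈)
                                (conn _ _ (anchor∈ x∈) (anchor∈ y∈)))
               (from-anchor y∈))

  induced-connected⁻ : ∀ {W} → ConnectedIn Hasse (_∈ induced W) → ConnectedIn (Adj G) (_∈ W)
  induced-connected⁻ conn u w u∈ w∈ =
    subst₂ (Path (Adj G) _) (anchor-vertex u) (anchor-vertex w)
      (Path-concatMap anchor anchor-step (vertex∈⁺ u∈) (conn _ _ (vertex∈⁺ u∈) (vertex∈⁺ w∈)))

  induced-lower : ∀ W → IsLowerSet _≺_ (_∈ induced W)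
  induced-lower W _ _ (_ , _ , refl , refl , ep) e∈ =
    vertex∈⁺ (endpoint-elim (_∈ W) ep (proj₁ (edge∈⁻ e∈)) (proj₂ (edge∈⁻ e∈)))

  tube⇒induced-tube : ∀ {W} → IsGraphTube G W → IsPosetTube _≺_ (induced W)
  tube⇒induced-tube {W} ((v , v∈) , conn) =
    filled-intro _ (v , vertex∈⁺ v∈) (λ e p q → edge∈⁺ (vertex∈⁻ p) (vertex∈⁻ q)) ,
    induced-connected conn , induced-lower W

  induced-tube⇒tube : ∀ {W} → Fin n → IsPosetTube _≺_ (induced W) → IsGraphTube G W
  induced-tube⇒tube v₀ (filled , conn , _) with filled⇒vertex v₀ filled
  ... | v , v∈ = (v , vertex∈⁻ v∈) , induced-connected⁻ conn

  posetTube≡induced : ∀ {t} → IsPosetTube _≺_ t → t ≡ induced (vertices t)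
  posetTube≡induced {t} (filled , _ , lower) = ⊆-antisym into onto
    where
    into : t ⊆ induced (vertices t)
    into {x} p with face x
    ... | vertexᶠ v = vertex∈⁺ (vertices∈⁺ p)
    ... | edgeᶠ e   = edge∈⁺ (vertices∈⁺ (lower _ _ (endpoint⇒≺ (inj₁ refl)) p))
                             (vertices∈⁺ (lower _ _ (endpoint⇒≺ (inj₂ refl)) p))
    onto : induced (vertices t) ⊆ t
    onto {x} p with face x
    ... | vertexᶠ v = vertices∈⁻ (vertex∈⁻ p)
    ... | edgeᶠ e   = filled⇒edgeClosed filled e (vertices∈⁻ (proj₁ (edge∈⁻ p)))
                                                 (vertices∈⁻ (proj₂ (edge∈⁻ p)))

  edge-within-tubing : ∀ {T W₁ W₂} e → IsGraphTubing G T → W₁ ∈ᶜ T → W₂ ∈ᶜ T →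
                       end₁ e ∈ W₁ → end₂ e ∈ W₂ →
                       (end₁ e ∈ W₂ × end₂ e ∈ W₂) ⊎ (end₁ e ∈ W₁ × end₂ e ∈ W₁)
  edge-within-tubing e tT W₁∈ W₂∈ a∈ b∈ with IsGraphTubing.nestdisj tT _ _ W₁∈ W₂∈
  ... | inj₁ (inj₁ W₁⊆W₂) = inj₁ (W₁⊆W₂ a∈ , b∈)
  ... | inj₁ (inj₂ W₂⊆W₁) = inj₂ (a∈ , W₂⊆W₁ b∈)
  ... | inj₂ disjoint     =
    ⊥-elim (IsGraphTubing.nonadj tT _ _ W₁∈ W₂∈ disjoint _ _ a∈ b∈ (e , inj₁ refl))

  no-edge-between : ∀ {W W'} → Disjoint W W' →
                    EdgeClosed (⋃ᶜ _≺_ (pair (induced W) (induced W'))) →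
                    ∀ e → end₁ e ∈ W → end₂ e ∈ W' → ⊥
  no-edge-between {W} {W'} disj closed e a∈ b∈
    with closed e (_ , ∈pairˡ (induced W) (induced W') , vertex∈⁺ a∈)
                   (_ , ∈pairʳ (induced W) (induced W') , vertex∈⁺ b∈)
  ... | r , r∈ , e∈ with ∈pair⁻ {r = r} r∈
  ...   | inj₁ refl = disj _ (proj₂ (edge∈⁻ e∈)) b∈
  ...   | inj₂ refl = disj _ a∈ (proj₁ (edge∈⁻ e∈))

  open Transport induced vertices vertices∘induced public

  graphTubing⇒posetTubing : ∀ {T} → IsGraphTubing G T → IsPosetTubing _≺_ (image T)
  graphTubing⇒posetTubing {T} tT = record
    { tubes = tubes ; proper = proper ; nestdisj = nestdisj ; unions = unions }
    where
    module GT = IsGraphTubing tT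

    tubes : ∀ t → t ∈ᶜ image T → IsPosetTube _≺_ t
    tubes t t∈ with ∈image⁻ {T} {t} t∈
    ... | image⁺ W∈ = tube⇒induced-tube (GT.tubes _ W∈)

    proper : ∀ t → t ∈ᶜ image T → t ≢ ⊤
    proper t t∈ with ∈image⁻ {T} {t} t∈
    ... | image⁺ W∈ = λ eq → GT.proper _ W∈ (induced-injective (trans eq (sym induced-⊤)))

    nestdisj : ∀ t t' → t ∈ᶜ image T → t' ∈ᶜ image T → NestedOrDisjoint t t'
    nestdisj t t' t∈ t'∈ with ∈image⁻ {T} {t} t∈ | ∈image⁻ {T} {t'} t'∈
    ... | image⁺ W∈ | image⁺ W'∈ = induced-nestedOrDisjoint (GT.nestdisj _ _ W∈ W'∈)

    unions : ∀ S → S ⊆ᶜ image T → (∃ λ t → t ∈ᶜ S) → IsFilled _≺_ (⋃ᶜ _≺_ S)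
    unions S S⊆ (t , t∈) = filled-intro _ (has-vertex (∈image⁻ (S⊆ t t∈)) t∈) closed
      where
      has-vertex : ∀ {t} → InImage T t → t ∈ᶜ S → ∃ λ v → ⋃ᶜ _≺_ S (vertex v)
      has-vertex (image⁺ W∈) t∈ with GT.tubes _ W∈
      ... | (v , v∈) , _ = v , _ , t∈ , vertex∈⁺ v∈

      covers : ∀ {t₁ t₂} e → InImage T t₁ → InImage T t₂ → t₁ ∈ᶜ S → t₂ ∈ᶜ S →
               vertex (end₁ e) ∈ t₁ → vertex (end₂ e) ∈ t₂ → ⋃ᶜ _≺_ S (edge e)
      covers e (image⁺ W₁∈) (image⁺ W₂∈) t₁∈ t₂∈ a∈ b∈
        with edge-within-tubing e tT W₁∈ W₂∈ (vertex∈⁻ a∈) (vertex∈⁻ b∈)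
      ... | inj₁ (a∈₂ , b∈₂) = _ , t₂∈ , edge∈⁺ a∈₂ b∈₂
      ... | inj₂ (a∈₁ , b∈₁) = _ , t₁∈ , edge∈⁺ a∈₁ b∈₁

      closed : EdgeClosed (⋃ᶜ _≺_ S)
      closed e (_ , t₁∈ , a∈) (_ , t₂∈ , b∈) =
        covers e (∈image⁻ (S⊆ _ t₁∈)) (∈image⁻ (S⊆ _ t₂∈)) t₁∈ t₂∈ a∈ b∈

  posetTubing⇒graphTubing : Fin n → ∀ {U} → IsPosetTubing _≺_ U → IsGraphTubing G (preimage U)
  posetTubing⇒graphTubing v₀ {U} tU = record
    { tubes    = λ W W∈ → induced-tube⇒tube v₀ (PT.tubes _ W∈)
    ; proper   = λ W W∈ W≡⊤ → PT.proper _ W∈ (trans (cong induced W≡⊤) induced-⊤)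
    ; nestdisj = λ W W' W∈ W'∈ → induced-nestedOrDisjoint⁻ (PT.nestdisj _ _ W∈ W'∈)
    ; nonadj   = nonadj
    }
    where
    module PT = IsPosetTubing tU

    pair-closed : ∀ {W W'} → W ∈ᶜ preimage U → W' ∈ᶜ preimage U →
                  EdgeClosed (⋃ᶜ _≺_ (pair (induced W) (induced W')))
    pair-closed {W} {W'} W∈ W'∈ =
      filled⇒edgeClosed
        (PT.unions _ (pair-⊆ W∈ W'∈) (induced W , ∈pairˡ (induced W) (induced W')))

    nonadj : ∀ W W' → W ∈ᶜ preimage U → W' ∈ᶜ preimage U → Disjoint W W' →
             ∀ u v → u ∈ W → v ∈ W' → ¬ Adj G u v
    nonadj W W' W∈ W'∈ disj u v u∈ v∈ adj with adj⇒joins adj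
    ... | e , inj₁ (refl , refl) = no-edge-between disj (pair-closed W∈ W'∈) e u∈ v∈
    ... | e , inj₂ (refl , refl) = no-edge-between (λ x p q → disj x q p) (pair-closed W'∈ W∈) e v∈ u∈

  posetTubing-lifts : ∀ {U} → IsPosetTubing _≺_ U → Lifts U
  posetTubing-lifts tU s s∈ = posetTube≡induced (IsPosetTubing.tubes tU s s∈)

proposition2p8 : (n : ℕ) → 0 < n → (G : Graph n) →
    TubingIso {n} {n + Graph.m G} {IsGraphTubing G} {IsPosetTubing (FaceLt G)}
proposition2p8 (suc _) _ G =
  tubingIso graphTubing⇒posetTubing (posetTubing⇒graphTubing zero) posetTubing-lifts
  where open FacePoset G
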